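{- If $\mathcal{I}$ and $\mathcal{J}$ are homogeneous ideals on $\omega$, then $\mathcal{I}\otimes\mathcal{J}$ is a homogeneous ideal on $\omega\times\omega$.
   Context: An ideal on a countable set $X$ is a family $\mathcal{I}\subseteq\mathcal{P}(X)$ closed under finite unions and subsets, containing all finite subsets of $X$, with $X\notin\mathcal{I}$. For $Y\subseteq X$, $\mathcal{I}|Y=\{A\cap Y: A\in\mathcal{I}\}$. Ideals $\mathcal{I}$ on $X$ and $\mathcal{J}$ on $Y$ are isomorphic, $\mathcal{I}\cong\mathcal{J}$, if there is a bijection $f\colon Y\to X$ with $A\in\mathcal{I}\iff f^{ -1}[A]\in\mathcal{J}$ for all $A\subseteq X$. For an ideal $\mathcal{I}$ on $X$, $H(\mathcal{I})=\{A\subseteq X:\ \mathcal{I}|A\cong\mathcal{I}\}$, and $\mathcal{I}$ is homogeneous if $H(\mathcal{I})=\{A\subseteq X: A\notin\mathcal{I}\}$. For ideals $\mathcal{I}$ on $X$ and $\mathcal{J}$ on $Y$, the product $\mathcal{I}\otimes\mathcal{J}$ is the ideal on $X\times Y$ given by $A\in\mathcal{I}\otimes\mathcal{J}\iff\{x\in X: A_x\notin\mathcal{J}\}\in\mathcal{I}$, where $A_x=\{y:(x,y)\in A\}$. -}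

module Defs where

open import Data.Nat using (ℕ)
open import Data.Bool using (Bool; true; false; T; not; _∨_)
open import Data.List using (List)
open import Data.List.Membership.Propositional using (_∈_)
open import Data.Product using (Σ; ∃; ∃-syntax; _×_; _,_; proj₁)
open import Relation.Nullary using (¬_; Dec)
open import Relation.Nullary.Decidable using (⌊_⌋)
open import Relation.Binary.PropositionalEquality using (_≡_)
open import Function.Bundles using (_⇔_; _⤖_; Bijection)

-- Classical logic (the paper's metatheory): every proposition is decidable.
LEM : Set₁
LEM = (P : Set) → Dec P

Subset : Set → Set
Subset X = X → Bool

full : {X : Set} → Subset X
full _ = true

_∪ˢ_ : {X : Set} → Subset X → Subset X → Subset X
(A ∪ˢ B) x = A x ∨ B x

_⊆ˢ_ : {X : Set} → Subset X → Subset X → Set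
A ⊆ˢ B = ∀ x → T (A x) → T (B x)

Finite : {X : Set} → Subset X → Set
Finite {X} A = Σ (List X) λ xs → ∀ x → T (A x) → x ∈ xs

Family : Set → Set₁
Family X = Subset X → Set

record IsIdeal {X : Set} (I : Family X) : Set where
  field
    ∪-closed   : ∀ A B → I A → I B → I (A ∪ˢ B)
    ⊆-closed   : ∀ A B → A ⊆ˢ B → I B → I A
    finite-mem : ∀ A → Finite A → I A
    full-not   : ¬ I full

⟦_⟧ : {X : Set} → Subset X → Set
⟦_⟧ {X} Y = Σ X λ x → T (Y x)

_∣_ : {X : Set} → Family X → (Y : Subset X) → Family ⟦ Y ⟧
(I ∣ Y) B = ∃[ A ] (I A × (∀ y → B y ≡ A (proj₁ y)))

_≅_ : {X Y : Set} → Family X → Family Y → Set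
_≅_ {X} {Y} I J =
  Σ (Y ⤖ X) λ f → ∀ (A : Subset X) → I A ⇔ J (λ y → A (Bijection.to f y))

H : {X : Set} → Family X → Subset X → Set
H I A = (I ∣ A) ≅ I

Homogeneous : {X : Set} → Family X → Set
Homogeneous {X} I = ∀ (A : Subset X) → H I A ⇔ (¬ I A)

-- Fubini product: A ∈ I ⊗ J iff { x : A_x ∉ J } ∈ I
section : {X Y : Set} → Subset (X × Y) → X → Subset Y
section A x y = A (x , y)

product : LEM → {X Y : Set} → Family X → Family Y → Family (X × Y)
product lem I J A = I (λ x → not ⌊ lem (J (section A x)) ⌋)

module Submission where

-- Let K = I ⊗ J and A ∉ K. Then B = { x : A_x ∉ J } ∉ I, so I|B ≅ I via some
-- f : ω → B, and for each x ∈ B, J|A_x ≅ J via some g_x : ω → A_x. Since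
-- membership in K depends only on which columns are J-positive, (n , m) ↦
-- (f n , g_{f n} m) carries K onto K|A, except that it misses the points of A
-- in columns outside B. These form a countable set, which is absorbed
-- (Hilbert-hotel style) into column 0; a single column is invisible to K.
-- Conversely, no A ∈ K has K|A ≅ K, for any ideal K.

open import Defs
open import Data.Bool using (Bool; true; false; T; not; _∧_; if_then_else_)
open import Data.Bool.Properties using (T?; T-irrelevant; T-≡; T-∧; T-∨)
open import Data.Empty using (⊥-elim)
open import Data.List using ([]; _∷_; map)
open import Data.List.Membership.Propositional.Properties using (∈-map⁺)
open import Data.List.Relation.Unary.Any using (here)
open import Data.Nat using (ℕ; zero; suc; _+_; _≡ᵇ_)
open import Data.Nat.Properties using (+-suc; +-identityʳ; suc-injective)
open import Data.Product using (Σ; ∃-syntax; _×_; _,_; proj₁; proj₂)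
open import Data.Product.Function.Dependent.Propositional using (Σ-↔)
open import Data.Sum using (_⊎_; inj₁; inj₂; map₁)
open import Data.Sum.Function.Propositional using (_⊎-↔_)
open import Data.Unit using (tt)
open import Function.Bundles using (_⇔_; _↔_; Inverse; Equivalence; Bijection; mk⇔; mk↔ₛ′)
open import Function.Properties.Bijection using (⤖⇒↔)
open import Function.Properties.Inverse using (↔-refl; ↔-sym; ↔-trans; ↔⇒⤖)
open import Function.Related.Propositional using (module EquationalReasoning)
open import Function.Construct.Symmetry using (⇔-sym)
open import Function.Construct.Composition using (_⇔-∘_)
open import Relation.Nullary using (¬_; yes; no; contradiction)
open import Relation.Nullary.Decidable using (⌊_⌋; does; isYes≗does; does-⇔; toWitnessFalse; fromWitnessFalse)
open import Relation.Binary.PropositionalEquality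
  using (_≡_; refl; sym; trans; cong; subst; module ≡-Reasoning)

T-or-T-not : ∀ b → T b ⊎ T (not b)
T-or-T-not true = inj₁ tt
T-or-T-not false = inj₂ tt

T-not⇒¬T : ∀ {b} → T (not b) → ¬ T b
T-not⇒¬T {false} _ ()

-- Extension is defined through this function rather than by 'with', so that a
-- section of an extension is definitionally the extension of a section.
_∧ᵈ_ : (b : Bool) → (T b → Bool) → Bool
true ∧ᵈ s = s tt
false ∧ᵈ s = false

∧ᵈ-true : ∀ {b} (s : T b → Bool) (p : T b) → b ∧ᵈ s ≡ s p
∧ᵈ-true {true} s tt = refl

∧ᵈ-elim : ∀ {b} (s : T b → Bool) → T (b ∧ᵈ s) → Σ (T b) λ p → T (s p)
∧ᵈ-elim {true} s t = tt , t

extend : {X : Set} (Y : Subset X) → Subset ⟦ Y ⟧ → Subset X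
extend Y S x = Y x ∧ᵈ λ p → S (x , p)

extend-⊆ : {X : Set} (Y : Subset X) (S : Subset ⟦ Y ⟧) → extend Y S ⊆ˢ Y
extend-⊆ Y S x t = proj₁ (∧ᵈ-elim _ t)

module _ {X : Set} {M : Family X} (isM : IsIdeal M) where
  open IsIdeal isM

  restrict⇔extend : (Y : Subset X) (S : Subset ⟦ Y ⟧) → (M ∣ Y) S ⇔ M (extend Y S)
  restrict⇔extend Y S = mk⇔
    (λ { (A , A∈M , S≡A) → ⊆-closed _ A (λ x t → let (p , s) = ∧ᵈ-elim _ t in
                                                   subst T (S≡A (x , p)) s) A∈M })
    (λ m → extend Y S , m , λ { (x , p) → sym (∧ᵈ-true _ p) })

  restrict⇔ : {Y A : Subset X} → A ⊆ˢ Y → (M ∣ Y) (λ y → A (proj₁ y)) ⇔ M A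
  restrict⇔ A⊆Y = mk⇔
    (λ { (A′ , A′∈M , A≡A′) → ⊆-closed _ A′ (λ x t → subst T (A≡A′ (x , A⊆Y x t)) t) A′∈M })
    (λ m → _ , m , λ _ → refl)

  H⇒extend⇔ : {Y : Subset X} (h : H M Y) (S : Subset ⟦ Y ⟧) →
    M (extend Y S) ⇔ M (λ x → S (Bijection.to (proj₁ h) x))
  H⇒extend⇔ {Y} (f , f-iso) S = f-iso S ⇔-∘ ⇔-sym (restrict⇔extend Y S)

  H⇒∉ : (A : Subset X) → H M A → ¬ M A
  H⇒∉ A (_ , iso) A∈M =
    full-not (Equivalence.to (iso full) (A , A∈M , λ y → sym (Equivalence.to T-≡ (proj₂ y))))

≐-off-zero⇒⇔ : {M : Family ℕ} → IsIdeal M → {W W′ : Subset ℕ} →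
  (∀ n → W (suc n) ≡ W′ (suc n)) → M W ⇔ M W′
≐-off-zero⇒⇔ {M} isM agree = mk⇔ (transfer agree) (transfer (λ n → sym (agree n)))
  where
  open IsIdeal isM

  zeroSet : Subset ℕ
  zeroSet n = n ≡ᵇ 0

  zeroSet∈M : M zeroSet
  zeroSet∈M = finite-mem zeroSet (0 ∷ [] , λ { zero _ → here refl })

  transfer : ∀ {W W′} → (∀ n → W (suc n) ≡ W′ (suc n)) → M W → M W′
  transfer {W} {W′} ≐ W∈M = ⊆-closed W′ (W ∪ˢ zeroSet) W′⊆ (∪-closed _ _ W∈M zeroSet∈M)
    where
    W′⊆ : W′ ⊆ˢ (W ∪ˢ zeroSet)
    W′⊆ zero _ = Equivalence.from T-∨ (inj₂ tt)
    W′⊆ (suc n) t = Equivalence.from T-∨ (inj₁ (subst T (sym (≐ n)) t))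

IsStartOrSuccessor : {X : Set} → X → (X → X) → X → Set
IsStartOrSuccessor start next x = x ≡ start ⊎ ∃[ x′ ] next x′ ≡ x

module Enumeration {X : Set} (start : X) (next : X → X) (rank : X → ℕ)
  (rank-start : rank start ≡ 0) (rank-next : ∀ x → rank (next x) ≡ suc (rank x))
  (start-or-successor : ∀ x → IsStartOrSuccessor start next x) where

  enum : ℕ → X
  enum zero = start
  enum (suc n) = next (enum n)

  rank-enum : ∀ n → rank (enum n) ≡ n
  rank-enum zero = rank-start
  rank-enum (suc n) = trans (rank-next (enum n)) (cong suc (rank-enum n))

  enum-rank≡ : ∀ n x → rank x ≡ n → enum n ≡ x
  enum-rank≡ n x r with start-or-successor x
  enum-rank≡ zero    _ r | inj₁ refl = refl
  enum-rank≡ (suc n) _ r | inj₁ refl with () ← trans (sym rank-start) r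
  enum-rank≡ zero    _ r | inj₂ (x′ , refl) with () ← trans (sym (rank-next x′)) r
  enum-rank≡ (suc n) _ r | inj₂ (x′ , refl) =
    cong next (enum-rank≡ n x′ (suc-injective (trans (sym (rank-next x′)) r)))

  ℕ↔ : ℕ ↔ X
  ℕ↔ = mk↔ₛ′ enum rank (λ x → enum-rank≡ (rank x) x refl) rank-enum

module CantorPairing where
  step : ℕ × ℕ → ℕ × ℕ
  step (zero , y) = suc y , 0
  step (suc x , y) = x , suc y

  triangle : ℕ → ℕ
  triangle zero = 0
  triangle (suc s) = triangle s + suc s

  cantor : ℕ × ℕ → ℕ
  cantor (x , y) = triangle (x + y) + y

  cantor-step : ∀ q → cantor (step q) ≡ suc (cantor q)
  cantor-step (zero , y) = begin
    triangle (suc y + 0) + 0  ≡⟨ +-identityʳ _ ⟩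
    triangle (suc y + 0)      ≡⟨ cong triangle (+-identityʳ (suc y)) ⟩
    triangle y + suc y        ≡⟨ +-suc (triangle y) y ⟩
    suc (triangle y + y)      ∎
    where open ≡-Reasoning
  cantor-step (suc x , y) = begin
    triangle (x + suc y) + suc y    ≡⟨ cong (λ s → triangle s + suc y) (+-suc x y) ⟩
    triangle (suc (x + y)) + suc y  ≡⟨ +-suc _ y ⟩
    suc (triangle (suc x + y) + y)  ∎
    where open ≡-Reasoning

  start-or-step : ∀ q → IsStartOrSuccessor (0 , 0) step q
  start-or-step (zero , zero) = inj₁ refl
  start-or-step (x , suc y) = inj₂ ((suc x , y) , refl)
  start-or-step (suc x , zero) = inj₂ ((zero , x) , refl)

  ℕ↔ℕ×ℕ : ℕ ↔ (ℕ × ℕ)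
  ℕ↔ℕ×ℕ = Enumeration.ℕ↔ (0 , 0) step cantor refl cantor-step start-or-step

-- Hilbert's hotel: guest inj₂ k is seated just before guest inj₁ k, and
-- count k is the number of guests inj₂ k′ with k′ < k.
module Hotel (d : ℕ → Bool) where
  Guest : Set
  Guest = ℕ ⊎ ⟦ d ⟧

  count : ℕ → ℕ
  count zero = 0
  count (suc k) = if d k then suc (count k) else count k

  count-suc-true : ∀ {k} → T (d k) → count (suc k) ≡ suc (count k)
  count-suc-true {k} p with d k
  ... | true = refl

  count-suc-false : ∀ {k} → ¬ T (d k) → count (suc k) ≡ count k
  count-suc-false {k} ¬p with d k
  ... | true = ⊥-elim (¬p tt)
  ... | false = refl

  first : ℕ → Guest
  first k with T? (d k)
  ... | yes p = inj₂ (k , p)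
  ... | no _ = inj₁ k

  next : Guest → Guest
  next (inj₁ k) = first (suc k)
  next (inj₂ (k , _)) = inj₁ k

  rank : Guest → ℕ
  rank (inj₁ k) = k + count (suc k)
  rank (inj₂ (k , _)) = k + count k

  first-true : ∀ {k} (p : T (d k)) → first k ≡ inj₂ (k , p)
  first-true {k} p with T? (d k)
  ... | yes p′ = cong (λ p → inj₂ (k , p)) (T-irrelevant p′ p)
  ... | no ¬p = contradiction p ¬p

  first-false : ∀ {k} → ¬ T (d k) → first k ≡ inj₁ k
  first-false {k} ¬p with T? (d k)
  ... | yes p = contradiction p ¬p
  ... | no _ = refl

  rank-first : ∀ k → rank (first k) ≡ k + count k
  rank-first k with T? (d k)
  ... | yes _ = refl
  ... | no ¬p = cong (k +_) (count-suc-false ¬p)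

  rank-next : ∀ g → rank (next g) ≡ suc (rank g)
  rank-next (inj₁ k) = rank-first (suc k)
  rank-next (inj₂ (k , p)) = trans (cong (k +_) (count-suc-true p)) (+-suc k (count k))

  first-start-or-successor : ∀ k → IsStartOrSuccessor (first 0) next (first k)
  first-start-or-successor zero = inj₁ refl
  first-start-or-successor (suc k) = inj₂ (inj₁ k , refl)

  start-or-successor : ∀ g → IsStartOrSuccessor (first 0) next g
  start-or-successor (inj₂ (k , p)) =
    subst (IsStartOrSuccessor (first 0) next) (first-true p) (first-start-or-successor k)
  start-or-successor (inj₁ k) with T? (d k)
  ... | yes p = inj₂ (inj₂ (k , p) , refl)
  ... | no ¬p =
    subst (IsStartOrSuccessor (first 0) next) (first-false ¬p) (first-start-or-successor k)

  ℕ↔ℕ⊎⟦⟧ : ℕ ↔ (ℕ ⊎ ⟦ d ⟧)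
  ℕ↔ℕ⊎⟦⟧ = Enumeration.ℕ↔ (first 0) next rank (rank-first 0) rank-next start-or-successor

ℕ↔ℕ⊎⟦⟧ : {X : Set} → ℕ ↔ X → (P : Subset X) → ℕ ↔ (ℕ ⊎ ⟦ P ⟧)
ℕ↔ℕ⊎⟦⟧ e P = ↔-trans (Hotel.ℕ↔ℕ⊎⟦⟧ (λ k → P (Inverse.to e k))) (↔-refl ⊎-↔ Σ-↔ e ↔-refl)

module _ {E : Set} (h : ℕ ↔ (ℕ ⊎ E)) where
  open Inverse h

  absorb : ℕ × ℕ → (ℕ × ℕ) ⊎ E
  absorb (zero , m) = map₁ (zero ,_) (to m)
  absorb (suc n , m) = inj₁ (suc n , m)

  unabsorb : (ℕ × ℕ) ⊎ E → ℕ × ℕ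
  unabsorb (inj₁ (zero , m)) = zero , from (inj₁ m)
  unabsorb (inj₁ (suc n , m)) = suc n , m
  unabsorb (inj₂ e) = zero , from (inj₂ e)

  unabsorb-zero : ∀ u → unabsorb (map₁ (zero ,_) u) ≡ (zero , from u)
  unabsorb-zero (inj₁ _) = refl
  unabsorb-zero (inj₂ _) = refl

  absorb-unabsorb : ∀ u → absorb (unabsorb u) ≡ u
  absorb-unabsorb (inj₁ (zero , m)) = cong (map₁ (zero ,_)) (strictlyInverseˡ (inj₁ m))
  absorb-unabsorb (inj₁ (suc n , m)) = refl
  absorb-unabsorb (inj₂ e) = cong (map₁ (zero ,_)) (strictlyInverseˡ (inj₂ e))

  unabsorb-absorb : ∀ q → unabsorb (absorb q) ≡ q
  unabsorb-absorb (zero , m) = trans (unabsorb-zero (to m)) (cong (zero ,_) (strictlyInverseʳ m))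
  unabsorb-absorb (suc n , m) = refl

  ℕ×ℕ↔ℕ×ℕ⊎ : (ℕ × ℕ) ↔ ((ℕ × ℕ) ⊎ E)
  ℕ×ℕ↔ℕ×ℕ⊎ = mk↔ₛ′ absorb unabsorb absorb-unabsorb unabsorb-absorb

module _ {X Y : Set} (A : Subset (X × Y)) (B : Subset X) where
  outside : Subset (X × Y)
  outside q = A q ∧ not (B (proj₁ q))

  Columns : Set
  Columns = Σ ⟦ B ⟧ λ z → ⟦ section A (proj₁ z) ⟧

  divide : ⟦ A ⟧ → Columns ⊎ ⟦ outside ⟧
  divide ((x , y) , a) with T-or-T-not (B x)
  ... | inj₁ b = inj₁ ((x , b) , (y , a))
  ... | inj₂ b̸ = inj₂ ((x , y) , Equivalence.from T-∧ (a , b̸))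

  join : Columns ⊎ ⟦ outside ⟧ → ⟦ A ⟧
  join (inj₁ ((x , _) , (y , a))) = (x , y) , a
  join (inj₂ (q , a)) = q , proj₁ (Equivalence.to T-∧ a)

  join-divide : ∀ a → join (divide a) ≡ a
  join-divide ((x , y) , a) with T-or-T-not (B x)
  ... | inj₁ _ = refl
  ... | inj₂ _ = cong ((x , y) ,_) (T-irrelevant _ _)

  divide-join : ∀ u → divide (join u) ≡ u
  divide-join (inj₁ ((x , b) , (y , a))) with T-or-T-not (B x)
  ... | inj₁ b′ = cong (λ b → inj₁ ((x , b) , (y , a))) (T-irrelevant b′ b)
  ... | inj₂ b̸ = contradiction b (T-not⇒¬T b̸)
  divide-join (inj₂ ((x , y) , o)) with T-or-T-not (B x)
  ... | inj₁ b = contradiction b (T-not⇒¬T (proj₂ (Equivalence.to T-∧ o)))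
  ... | inj₂ _ = cong (λ o → inj₂ ((x , y) , o)) (T-irrelevant _ _)

  ⟦⟧↔Columns⊎outside : ⟦ A ⟧ ↔ (Columns ⊎ ⟦ outside ⟧)
  ⟦⟧↔Columns⊎outside = mk↔ₛ′ divide join divide-join join-divide

module _ (lem : LEM) {X Y : Set} (J : Family Y) where
  largeColumns : Subset (X × Y) → Subset X
  largeColumns A x = not ⌊ lem (J (section A x)) ⌋

  largeColumns-cong : {A A′ : Subset (X × Y)} {x x′ : X} →
    J (section A x) ⇔ J (section A′ x′) → largeColumns A x ≡ largeColumns A′ x′
  largeColumns-cong j⇔j′ = cong not (begin
    ⌊ lem _ ⌋     ≡⟨ isYes≗does (lem _) ⟩
    does (lem _)  ≡⟨ does-⇔ j⇔j′ (lem _) (lem _) ⟩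
    does (lem _)  ≡⟨ isYes≗does (lem _) ⟨
    ⌊ lem _ ⌋     ∎)
    where open ≡-Reasoning

  module _ (isJ : IsIdeal J) where
    private module J = IsIdeal isJ

    largeColumns-mono : {A A′ : Subset (X × Y)} → A ⊆ˢ A′ → largeColumns A ⊆ˢ largeColumns A′
    largeColumns-mono A⊆A′ x t = fromWitnessFalse λ j →
      toWitnessFalse t (J.⊆-closed _ _ (λ y → A⊆A′ (x , y)) j)

    largeColumns-∪ : (A A′ : Subset (X × Y)) →
      largeColumns (A ∪ˢ A′) ⊆ˢ (largeColumns A ∪ˢ largeColumns A′)
    largeColumns-∪ A A′ x t with lem (J (section A x)) | lem (J (section A′ x))
    ... | yes j | yes j′ = toWitnessFalse t (J.∪-closed _ _ j j′)
    ... | no _ | _ = tt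
    ... | yes _ | no _ = tt

    largeColumns-finite : {A : Subset (X × Y)} → Finite A → ∀ x → ¬ T (largeColumns A x)
    largeColumns-finite (xs , cover) x t = toWitnessFalse t
      (J.finite-mem _ (map proj₂ xs , λ y a → ∈-map⁺ proj₂ (cover (x , y) a)))

    largeColumns-full : ∀ x → T (largeColumns full x)
    largeColumns-full x = fromWitnessFalse J.full-not

module _ (lem : LEM) {I J : Family ℕ} (isI : IsIdeal I) (isJ : IsIdeal J) where
  private
    module I = IsIdeal isI

  product-isIdeal : IsIdeal (product lem I J)
  product-isIdeal = record
    { ∪-closed = λ A A′ A∈ A′∈ →
        I.⊆-closed _ _ (largeColumns-∪ lem J isJ A A′) (I.∪-closed _ _ A∈ A′∈)
    ; ⊆-closed = λ A A′ A⊆A′ → I.⊆-closed _ _ (largeColumns-mono lem J isJ A⊆A′)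
    ; finite-mem = λ A finA → I.⊆-closed _ (λ _ → false)
        (λ x t → ⊥-elim (largeColumns-finite lem J isJ finA x t))
        (I.finite-mem _ ([] , λ _ ()))
    ; full-not = λ full∈ → I.full-not
        (I.⊆-closed full _ (λ x _ → largeColumns-full lem J isJ x) full∈)
    }

module ProductHomogeneity (lem : LEM) {I J : Family ℕ}
         (isI : IsIdeal I) (hI : Homogeneous I) (isJ : IsIdeal J) (hJ : Homogeneous J)
         (A : Subset (ℕ × ℕ)) (A∉I⊗J : ¬ product lem I J A) where

  B : Subset ℕ
  B = largeColumns lem J A

  B∈H : H I B
  B∈H = Equivalence.from (hI B) A∉I⊗J

  f : ℕ ↔ ⟦ B ⟧
  f = ⤖⇒↔ (proj₁ B∈H)

  column∈H : (z : ⟦ B ⟧) → H J (section A (proj₁ z))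
  column∈H (x , b) = Equivalence.from (hJ _) (toWitnessFalse b)

  g : (z : ⟦ B ⟧) → ℕ ↔ ⟦ section A (proj₁ z) ⟧
  g z = ⤖⇒↔ (proj₁ (column∈H z))

  -- Column suc n goes onto the column of f (suc n) through g; column 0 onto
  -- the column of f 0 together with the points of A outside B.
  φ : (ℕ × ℕ) ↔ ⟦ A ⟧
  φ = ↔-trans (ℕ×ℕ↔ℕ×ℕ⊎ (ℕ↔ℕ⊎⟦⟧ CantorPairing.ℕ↔ℕ×ℕ (outside A B)))
        (↔-trans (Σ-↔ f (λ {n} → g (Inverse.to f n)) ⊎-↔ ↔-refl)
                 (↔-sym (⟦⟧↔Columns⊎outside A B)))

  module _ (S : Subset ⟦ A ⟧) where
    U : Subset ℕ
    U = largeColumns lem J (extend A S)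

    column-suc : ∀ n → U (proj₁ (Inverse.to f (suc n))) ≡
                       largeColumns lem J (λ q → S (Inverse.to φ q)) (suc n)
    column-suc n = largeColumns-cong lem J {extend A S} {λ q → S (Inverse.to φ q)}
      {proj₁ z} {suc n}
      (H⇒extend⇔ isJ (column∈H z) W)
      where
      z : ⟦ B ⟧
      z = Inverse.to f (suc n)
      W : Subset ⟦ section A (proj₁ z) ⟧
      W v = S ((proj₁ z , proj₁ v) , proj₂ v)

    U⊆B : U ⊆ˢ B
    U⊆B = largeColumns-mono lem J isJ (extend-⊆ A S)

    φ-preserves : (product lem I J ∣ A) S ⇔ product lem I J (λ q → S (Inverse.to φ q))
    φ-preserves = begin
      (product lem I J ∣ A) S
        ∼⟨ restrict⇔extend (product-isIdeal lem isI isJ) A S ⟩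
      I U
        ∼⟨ ⇔-sym (restrict⇔ isI U⊆B) ⟩
      (I ∣ B) (λ z → U (proj₁ z))
        ∼⟨ proj₂ B∈H _ ⟩
      I (λ n → U (proj₁ (Inverse.to f n)))
        ∼⟨ ≐-off-zero⇒⇔ isI column-suc ⟩
      product lem I J (λ q → S (Inverse.to φ q))
        ∎
      where open EquationalReasoning

  ∉⇒H : H (product lem I J) A
  ∉⇒H = ↔⇒⤖ φ , φ-preserves

mainTheorem4 : (lem : LEM) (I J : Family ℕ) →
    IsIdeal I → Homogeneous I → IsIdeal J → Homogeneous J →
    IsIdeal (product lem I J) × Homogeneous (product lem I J)
mainTheorem4 lem I J isI hI isJ hJ =
  I⊗J-isIdeal , λ A → mk⇔ (H⇒∉ I⊗J-isIdeal A) (ProductHomogeneity.∉⇒H lem isI hI isJ hJ A)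
  where
  I⊗J-isIdeal : IsIdeal (product lem I J)
  I⊗J-isIdeal = product-isIdeal lem isI isJ
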